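{- Let $M_1=\langle W_\mu,\mu,\mathcal{F}^\mu,V_\mu\rangle$ and $M_2=\langle W_\tau,\tau,\mathcal{F}^\tau,V_\tau\rangle$ be consistent gtf-models, let $T$ be a generalized $1$-topo-bisimulation between them, and let $w\in W_\mu$, $w'\in W_\tau$ with $wTw'$. Then for every formula $\varphi$, $w\Vdash_\mu\varphi$ iff $w'\Vdash_\tau\varphi$.
   Context: Formulas are built from a countable set $PV$ of propositional variables using $\bot,\lnot,\land,\lor,\to,\Box$. A generalized topology on a nonempty set $W$ is a family $\mu\subseteq P(W)$ with $\emptyset\in\mu$ and closed under unions of arbitrary nonempty subfamilies; $\bigcup\mu$ is the union of its members. A gtf-model is $\langle W,\mu,\mathcal{F},V\rangle$ where $\mu$ is a generalized topology on $W$, $V:PV\to P(W)$, and $\mathcal{F}:W\to P(P(\bigcup\mu))$ satisfies: if $w\in\bigcup\mu$ then $X\in\mathcal{F}_w$ iff ($X\in\mu$ and $w\in X$); if $w\notin\bigcup\mu$ then $\mathcal{F}_w\subseteq\mu$. Satisfaction: $w\Vdash q$ iff $w\in V(q)$; Boolean clauses classical; $w\Vdash\Box\varphi$ iff there is $O\in\mathcal{F}_w$ with $v\Vdash\varphi$ for all $v\in O$. A model is consistent if $\emptyset\notin\mathcal{F}_w$ for every world $w$. A generalized $1$-topo-bisimulation between $M_1$ and $M_2$ is a nonempty relation $T\subseteq W_\mu\times W_\tau$ such that whenever $wTw'$: (1) for every $q\in PV$, $w\in V_\mu(q)$ iff $w'\in V_\tau(q)$; (2) if $O\in\mu$, $O\neq\emptyset$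 and $O\in\mathcal{F}^\mu_w$, then there is $O'\in\mathcal{F}^\tau_{w'}$ such that for each $v'\in O'$ there is $v\in O$ with $vTv'$; (3) if $O'\in\tau$, $O'\neq\emptyset$ and $O'\in\mathcal{F}^\tau_{w'}$, then there is $O\in\mathcal{F}^\mu_w$ such that for each $v\in O$ there is $v'\in O'$ with $vTv'$. -}

module Defs where

open import Level using (Level; 0ℓ; Lift) renaming (suc to lsuc)
open import Data.Nat using (ℕ)
open import Data.Empty using (⊥)
open import Data.Product using (Σ; _×_; _,_)
open import Data.Sum using (_⊎_)
open import Relation.Nullary using (¬_)

data Form : Set where
  var  : ℕ → Form
  ⊥'   : Form
  ¬'_  : Form → Form
  _∧'_ : Form → Form → Form
  _∨'_ : Form → Form → Form
  _⇒'_ : Form → Form → Form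
  □_   : Form → Form

Subset : Set → Set₁
Subset W = W → Set

∅ : {W : Set} → Subset W
∅ _ = ⊥

_≐_ : {W : Set} → Subset W → Subset W → Set
X ≐ Y = ∀ v → (X v → Y v) × (Y v → X v)

Family : Set → Set₁
Family W = Subset W → Set

⋃ : {W : Set} → Family W → W → Set₁
⋃ {W} μ w = Σ (Subset W) λ X → μ X × X w

record IsGenTop (W : Set) (μ : Family W) : Set₁ where
  field
    ext      : ∀ {X Y} → X ≐ Y → μ X → μ Y
    ∅∈       : μ ∅
    ⋃-closed : {I : Set} (f : I → Subset W) → I →
               (∀ i → μ (f i)) → μ (λ w → Σ I λ i → f i w)

record GTFModel : Set₂ where
  field
    W      : Set
    w₀     : W
    μ      : Family W
    isGT   : IsGenTop W μ
    F      : W → Family W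
    F-ext  : ∀ {w X Y} → X ≐ Y → F w X → F w Y
    F-sub  : ∀ w X → F w X → ∀ v → X v → ⋃ μ v
    F-in   : ∀ w → ⋃ μ w → ∀ X → (F w X → μ X × X w) × (μ X × X w → F w X)
    F-out  : ∀ w → ¬ ⋃ μ w → ∀ X → F w X → μ X
    V      : ℕ → Subset W

module _ (M : GTFModel) where
  open GTFModel M

  infix 4 _⊩_
  _⊩_ : W → Form → Set₁
  w ⊩ var q    = Lift _ (V q w)
  w ⊩ ⊥'       = Lift _ ⊥
  w ⊩ ¬' φ     = ¬ (w ⊩ φ)
  w ⊩ (φ ∧' ψ) = (w ⊩ φ) × (w ⊩ ψ)
  w ⊩ (φ ∨' ψ) = (w ⊩ φ) ⊎ (w ⊩ ψ)
  w ⊩ (φ ⇒' ψ) = (w ⊩ φ) → (w ⊩ ψ)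
  w ⊩ (□ φ)    = Σ (Subset W) λ O → F w O × (∀ v → O v → v ⊩ φ)

  Consistent : Set
  Consistent = ∀ w → ¬ F w ∅

Sat : (M : GTFModel) → GTFModel.W M → Form → Set₁
Sat M = _⊩_ M

record Gen1TopoBisim (M₁ M₂ : GTFModel) : Set₂ where
  module M₁ = GTFModel M₁
  module M₂ = GTFModel M₂
  field
    T        : M₁.W → M₂.W → Set
    nonempty : Σ M₁.W λ w → Σ M₂.W λ w' → T w w'
    atoms    : ∀ {w w'} → T w w' → ∀ q → (M₁.V q w → M₂.V q w') × (M₂.V q w' → M₁.V q w)
    forth    : ∀ {w w'} → T w w' → ∀ O → M₁.μ O → ¬ (∀ v → ¬ O v) → M₁.F w O →
               Σ (Subset M₂.W) λ O' → M₂.F w' O' × (∀ v' → O' v' → Σ M₁.W λ v → O v × T v v')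
    back     : ∀ {w w'} → T w w' → ∀ O' → M₂.μ O' → ¬ (∀ v' → ¬ O' v') → M₂.F w' O' →
               Σ (Subset M₁.W) λ O → M₁.F w O × (∀ v → O v → Σ M₂.W λ v' → O' v' × T v v')

-- Only □ needs thought: a neighbourhood O of w
-- is open (using excluded middle on w ∈ ⋃μ to pick the clause of the frame
-- condition) and inhabited (by consistency), so the forth/back clause of the
-- bisimulation applies to it, and the induction hypothesis carries φ from O
-- to the matching neighbourhood O' of w', and back.
module Submission where

open import Defs
open import Level using (0ℓ; lift; lower) renaming (suc to lsuc)
open import Axiom.ExcludedMiddle using (ExcludedMiddle)
open import Data.Product using (Σ; _×_; _,_; proj₁; proj₂)
open import Data.Sum using (inj₁; inj₂)
open import Function using (flip)
open import Relation.Nullary using (yes; no; ¬_)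

module _ (M : GTFModel) where
  open GTFModel M

  neighbourhood-open : ExcludedMiddle (lsuc 0ℓ) → ∀ w O → F w O → μ O
  neighbourhood-open em w O O∈F with em {⋃ μ w}
  ... | yes w∈⋃μ = proj₁ (proj₁ (F-in w w∈⋃μ O) O∈F)
  ... | no  w∉⋃μ = F-out w w∉⋃μ O O∈F

  neighbourhood-inhabited : Consistent M → ∀ w O → F w O → ¬ (∀ v → ¬ O v)
  neighbourhood-inhabited consistent w O O∈F O-empty =
    consistent w (F-ext (λ v → (λ v∈O → O-empty v v∈O) , λ ()) O∈F)

Forth : (M N : GTFModel) → (GTFModel.W M → GTFModel.W N → Set) → Set₁
Forth M N R = ∀ {w w'} → R w w' → ∀ O → GTFModel.F M w O →
  Σ (Subset (GTFModel.W N)) λ O' → GTFModel.F N w' O' ×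
    (∀ v' → O' v' → Σ (GTFModel.W M) λ v → O v × R v v')

□-preserved : (M N : GTFModel) (R : GTFModel.W M → GTFModel.W N → Set) →
  Forth M N R → (φ : Form) →
  (∀ {v v'} → R v v' → Sat M v φ → Sat N v' φ) →
  ∀ {w w'} → R w w' → Sat M w (□ φ) → Sat N w' (□ φ)
□-preserved M N R forth φ preserves wRw' (O , O∈Fw , O⊩φ) =
  let (O' , O'∈Fw' , covered) = forth wRw' O O∈Fw
  in O' , O'∈Fw' , λ v' v'∈O' →
       let (v , v∈O , vRv') = covered v' v'∈O' in preserves vRv' (O⊩φ v v∈O)

module _ (em : ExcludedMiddle (lsuc 0ℓ)) {M₁ M₂ : GTFModel}
         (consistent₁ : Consistent M₁) (consistent₂ : Consistent M₂)
         (B : Gen1TopoBisim M₁ M₂) where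
  open Gen1TopoBisim B

  bisim-forth : Forth M₁ M₂ T
  bisim-forth {w} wTw' O O∈Fw = forth wTw' O
    (neighbourhood-open M₁ em w O O∈Fw)
    (neighbourhood-inhabited M₁ consistent₁ w O O∈Fw) O∈Fw

  bisim-back : Forth M₂ M₁ (flip T)
  bisim-back {w'} wTw' O' O'∈Fw' = back wTw' O'
    (neighbourhood-open M₂ em w' O' O'∈Fw')
    (neighbourhood-inhabited M₂ consistent₂ w' O' O'∈Fw') O'∈Fw'

  bisim-invariant : ∀ {w w'} → T w w' → (φ : Form) →
    (Sat M₁ w φ → Sat M₂ w' φ) × (Sat M₂ w' φ → Sat M₁ w φ)
  bisim-invariant t (var q) =
    (λ x → lift (proj₁ (atoms t q) (lower x))) , (λ x → lift (proj₂ (atoms t q) (lower x)))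
  bisim-invariant t ⊥' = (λ x → x) , (λ x → x)
  bisim-invariant t (¬' φ) =
    let (to , from) = bisim-invariant t φ
    in (λ ¬a b → ¬a (from b)) , (λ ¬b a → ¬b (to a))
  bisim-invariant t (φ ∧' ψ) =
    let (toφ , fromφ) = bisim-invariant t φ
        (toψ , fromψ) = bisim-invariant t ψ
    in (λ (a , b) → toφ a , toψ b) , (λ (a , b) → fromφ a , fromψ b)
  bisim-invariant t (φ ∨' ψ) =
    let (toφ , fromφ) = bisim-invariant t φ
        (toψ , fromψ) = bisim-invariant t ψ
    in (λ { (inj₁ a) → inj₁ (toφ a) ; (inj₂ b) → inj₂ (toψ b) }) ,
       (λ { (inj₁ a) → inj₁ (fromφ a) ; (inj₂ b) → inj₂ (fromψ b) })
  bisim-invariant t (φ ⇒' ψ) =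
    let (toφ , fromφ) = bisim-invariant t φ
        (toψ , fromψ) = bisim-invariant t ψ
    in (λ f a → toψ (f (fromφ a))) , (λ f a → fromψ (f (toφ a)))
  bisim-invariant t (□ φ) =
    □-preserved M₁ M₂ T bisim-forth φ (λ s → proj₁ (bisim-invariant s φ)) t ,
    □-preserved M₂ M₁ (flip T) bisim-back φ (λ s → proj₂ (bisim-invariant s φ)) t

mainTheorem9 : ExcludedMiddle (lsuc 0ℓ) →
    (M₁ M₂ : GTFModel) → Consistent M₁ → Consistent M₂ →
    (B : Gen1TopoBisim M₁ M₂) →
    (w : GTFModel.W M₁) (w' : GTFModel.W M₂) → Gen1TopoBisim.T B w w' →
    (φ : Form) → (Sat M₁ w φ → Sat M₂ w' φ) × (Sat M₂ w' φ → Sat M₁ w φ)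
mainTheorem9 em M₁ M₂ consistent₁ consistent₂ B _ _ =
  bisim-invariant em consistent₁ consistent₂ B
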